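{- Every cyclic balanced composition has exactly two odd entries.
   Context: A composition of $n$ is a tuple $(c_1,\ldots,c_r)$ of positive integers with sum $n$. Its associated reverse layered permutation is, in one-line notation, $(n-c_1+1)\cdots(n)\,(n-c_1-c_2+1)\cdots(n-c_1)\cdots(1)\cdots(c_r)$ (values split into consecutive blocks of sizes $c_1,\ldots,c_r$, blocks in decreasing order of values, each block increasing). The composition is cyclic if this permutation is a single $n$-cycle, and balanced if some prefix $c_1,\ldots,c_j$ has sum $n/2$. -}

module Defs where

open import Data.Nat using (ℕ; zero; suc; _+_; _*_; _∸_; _<_; _<?_; _%_)
open import Data.Nat.Properties using (_≟_)
open import Data.List using (List; []; _∷_; take; length; filter)
open import Data.Nat.ListAction using (sum)
open import Data.List.Relation.Unary.All using (All)
open import Data.Product using (∃; _×_)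
open import Relation.Nullary.Decidable using (does)
open import Data.Bool using (if_then_else_)
open import Relation.Binary.PropositionalEquality using (_≡_)

IsComposition : ℕ → List ℕ → Set
IsComposition n cs = All (λ c → 0 < c) cs × sum cs ≡ n

-- Reverse layered permutation, 0-indexed: rlp n cs i is the (0-indexed)
-- value at (0-indexed) position i.
rlp : ℕ → List ℕ → ℕ → ℕ
rlp n [] i = i
rlp n (c ∷ cs) i =
  if does (i <? c) then (n ∸ c) + i else rlp (n ∸ c) cs (i ∸ c)

iter : (ℕ → ℕ) → ℕ → ℕ → ℕ
iter f zero x = x
iter f (suc k) x = f (iter f k x)

-- Cyclic: the permutation on {0,..,n-1} (n = sum cs) is a single n-cycle,
-- i.e. n ≥ 1 and the orbit of 0 contains every element of {0,..,n-1}.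
Cyclic : List ℕ → Set
Cyclic cs = 0 < sum cs × (∀ j → j < sum cs → ∃ λ k → iter (rlp (sum cs) cs) k 0 ≡ j)

Balanced : List ℕ → Set
Balanced cs = ∃ λ j → 2 * sum (take j cs) ≡ sum cs

numOdd : List ℕ → ℕ
numOdd cs = length (filter (λ c → c % 2 ≟ 1) cs)

module Submission where

-- Write n = sum cs and π = rlp n cs, and call y the mirror image of x in
-- {0, …, n-1} when x + y = n - 1.  The proof has three parts.
-- (1) Counting block by block, an entry c contributes a point x of its block that
--     π sends to its mirror image iff c is odd, so numOdd cs counts the x < n
--     mirrored by π (numOdd-mirrored).
-- (2) π is self-adjoint for mirroring (π z mirrors y iff π y mirrors z), and if
--     the prefix sum m is n/2 then π swaps [0, m) and [m, n) (balanced-halves).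
-- (3) Any such map whose orbit of 0 covers [0, n) mirrors exactly two points
--     (module HalfSwapping): the orbit has exact period n (module CyclicOrbit);
--     orbit k is mirrored iff the orbit visits top = n - 1 at time 2k + 1; the
--     orbit alternates between the halves, so top is visited at an odd time
--     2a + 1; and 2k + 1 ≡ 2a + 1 (mod 2m) has exactly the solutions a, a + m.
-- The theorem at the end combines (1), (2) and (3).

open import Defs
open import Level using (Level)
open import Data.Nat
open import Data.Nat.Properties
open import Data.Nat.DivMod using (m≡m%n+[m/n]*n; m%n<n)
open import Data.Nat.Tactic.RingSolver using (solve-∀)
open import Data.Nat.ListAction using (sum)
open import Data.Nat.ListAction.Properties using (sum-++)
open import Data.Bool using (true; false; if_then_else_)
open import Data.List using (List; []; _∷_; _++_; take; drop)
open import Data.List.Properties using (take++drop≡id)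
open import Data.Fin using (Fin; toℕ; fromℕ<)
open import Data.Fin.Properties using (pigeonhole; toℕ-fromℕ<; toℕ<n)
open import Data.Product using (∃; _×_; _,_; proj₁; proj₂)
open import Data.Sum using (_⊎_; inj₁; inj₂) renaming (map to ⊎-map)
open import Function.Bundles using (_⇔_; mk⇔; Equivalence)
open import Function.Construct.Composition using (_⇔-∘_)
open import Function.Construct.Identity using (⇔-id)
open import Relation.Nullary using (yes; no; ¬_; does; contradiction)
open import Relation.Nullary.Decidable using (does-⇔; dec-true; dec-false; map′)
open import Relation.Unary using (Pred; Decidable)
open import Relation.Unary.Properties using (_∪?_)
open import Relation.Binary.PropositionalEquality
open import Relation.Binary.Definitions using (tri<; tri≈; tri>)

private variable
  ℓ : Level
  P Q : Pred ℕ ℓ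

count : Decidable P → ℕ → ℕ
count P? zero = 0
count P? (suc N) = if does (P? N) then suc (count P? N) else count P? N

count-cong : (P? : Decidable P) (Q? : Decidable Q) →
             ∀ N → (∀ x → x < N → P x ⇔ Q x) → count P? N ≡ count Q? N
count-cong P? Q? zero _ = refl
count-cong P? Q? (suc N) P⇔Q
  rewrite count-cong P? Q? N (λ x x<N → P⇔Q x (m<n⇒m<1+n x<N))
        | does-⇔ (P⇔Q N ≤-refl) (P? N) (Q? N) = refl

count-+ : (P? : Decidable P) → ∀ a b →
          count P? (a + b) ≡ count P? a + count (λ x → P? (a + x)) b
count-+ P? a zero = trans (cong (count P?) (+-identityʳ a)) (sym (+-identityʳ _))
count-+ P? a (suc b) rewrite +-suc a b with P? (a + b)
... | yes _ = trans (cong suc (count-+ P? a b)) (sym (+-suc _ _))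
... | no _ = count-+ P? a b

count-none : (P? : Decidable P) → ∀ N → (∀ x → x < N → ¬ P x) → count P? N ≡ 0
count-none P? zero _ = refl
count-none P? (suc N) ¬P with P? N
... | yes p = contradiction p (¬P N ≤-refl)
... | no _ = count-none P? N (λ x x<N → ¬P x (m<n⇒m<1+n x<N))

count-∪ : (P? : Decidable P) (Q? : Decidable Q) → (∀ x → P x → ¬ Q x) →
          ∀ N → count (P? ∪? Q?) N ≡ count P? N + count Q? N
count-∪ P? Q? disjoint zero = refl
count-∪ P? Q? disjoint (suc N) with P? N | Q? N
... | yes p | yes q = contradiction q (disjoint N p)
... | yes _ | no _ = cong suc (count-∪ P? Q? disjoint N)
... | no _ | yes _ = trans (cong suc (count-∪ P? Q? disjoint N)) (sym (+-suc _ _))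
... | no _ | no _ = count-∪ P? Q? disjoint N

count-one : (P? : Decidable P) → ∀ {u N} → u < N → P u →
            (∀ x → x < N → P x → x ≡ u) → count P? N ≡ 1
count-one P? {u} {N} u<N Pu unique = begin
  count P? N                                     ≡⟨ cong (count P?) (m+[n∸m]≡n u<N) ⟨
  count P? (suc u + r)                           ≡⟨ count-+ P? (suc u) r ⟩
  count P? (suc u) + count (λ x → P? (suc u + x)) r ≡⟨ cong₂ _+_ up-to-u beyond-u ⟩
  1                                              ∎
  where
  open ≡-Reasoning
  r : ℕ
  r = N ∸ suc u
  up-to-u : count P? (suc u) ≡ 1
  up-to-u with P? u
  ... | yes _ = cong suc (count-none P? u λ x x<u Px → <-irrefl (unique x (<-trans x<u u<N) Px) x<u)
  ... | no ¬Pu = contradiction Pu ¬Pu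
  beyond-u : count (λ x → P? (suc u + x)) r ≡ 0
  beyond-u = count-none (λ x → P? (suc u + x)) r λ x x<r Px →
    <-irrefl (sym (unique _ (subst (suc u + x <_) (m+[n∸m]≡n u<N) (+-monoʳ-< (suc u) x<r)) Px))
             (s≤s (m≤m+n u x))

count-two : (P? : Decidable P) → ∀ {u v N} → u < N → v < N → u ≢ v → P u → P v →
            (∀ x → x < N → P x → x ≡ u ⊎ x ≡ v) → count P? N ≡ 2
count-two {P = P} P? {u} {v} {N} u<N v<N u≢v Pu Pv witnesses = begin
  count P? N                       ≡⟨ count-cong P? ((_≟ u) ∪? (_≟ v)) N
                                        (λ x x<N → mk⇔ (witnesses x x<N) (from x)) ⟩
  count ((_≟ u) ∪? (_≟ v)) N       ≡⟨ count-∪ (_≟ u) (_≟ v) (λ x x≡u x≡v → u≢v (trans (sym x≡u) x≡v)) N ⟩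
  count (_≟ u) N + count (_≟ v) N  ≡⟨ cong₂ _+_ (point u<N) (point v<N) ⟩
  2                                ∎
  where
  open ≡-Reasoning
  from : ∀ x → x ≡ u ⊎ x ≡ v → P x
  from x (inj₁ refl) = Pu
  from x (inj₂ refl) = Pv
  point : ∀ {w} → w < N → count (_≟ w) N ≡ 1
  point w<N = count-one (_≟ _) w<N refl (λ _ _ x≡w → x≡w)

halve : ∀ c → c ≡ c % 2 + 2 * (c / 2)
halve c = trans (m≡m%n+[m/n]*n c 2) (cong (c % 2 +_) (*-comm (c / 2) 2))

odd-form : ∀ c → c % 2 ≡ 1 → c ≡ suc (2 * (c / 2))
odd-form c odd = trans (halve c) (cong (_+ 2 * (c / 2)) odd)

even-form : ∀ c → c % 2 ≢ 1 → c ≡ 2 * (c / 2)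
even-form c even = trans (halve c) (cong (_+ 2 * (c / 2)) (remainder-0 (c % 2) (m%n<n c 2) even))
  where
  remainder-0 : ∀ r → r < 2 → r ≢ 1 → r ≡ 0
  remainder-0 0 _ _ = refl
  remainder-0 1 _ r≢1 = contradiction refl r≢1
  remainder-0 (suc (suc _)) (s≤s (s≤s ())) _

numOdd-∷ : ∀ c cs → numOdd (c ∷ cs) ≡ numOdd (c ∷ []) + numOdd cs
numOdd-∷ c cs with does (c % 2 ≟ 1)
... | true = refl
... | false = refl

odd-block : ∀ c → count (λ x → suc (2 * x) ≟ c) c ≡ numOdd (c ∷ [])
odd-block c with c % 2 ≟ 1
... | yes odd rewrite dec-true (c % 2 ≟ 1) odd =
  count-one (λ x → suc (2 * x) ≟ c) h<c (sym c≡) centre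
  where
  h : ℕ
  h = c / 2
  c≡ : c ≡ suc (2 * h)
  c≡ = odd-form c odd
  h<c : h < c
  h<c = subst (h <_) (sym c≡) (s≤s (m≤n*m h 2))
  centre : ∀ x → x < c → suc (2 * x) ≡ c → x ≡ h
  centre x _ e = *-cancelˡ-≡ x h 2 (suc-injective (trans e c≡))
... | no even rewrite dec-false (c % 2 ≟ 1) even = count-none (λ x → suc (2 * x) ≟ c) c
        (λ x _ e → even≢odd (c / 2) x (trans (sym (even-form c even)) (sym e)))

record Mirror (n x y : ℕ) : Set where
  constructor mirror
  field sums : suc (x + y) ≡ n
open Mirror

mirror-sym : ∀ {n x y} → Mirror n x y → Mirror n y x
mirror-sym {x = x} {y} (mirror e) = mirror (trans (cong suc (+-comm y x)) e)

mirror-unique : ∀ {n x y y′} → Mirror n x y → Mirror n x y′ → y ≡ y′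
mirror-unique {x = x} (mirror e) (mirror e′) = +-cancelˡ-≡ x _ _ (suc-injective (trans e (sym e′)))

mirror-exists : ∀ {n y} → y < n → Mirror n (n ∸ suc y) y
mirror-exists {n} {y} y<n = mirror (trans (sym (+-suc (n ∸ suc y) y)) (m∸n+n≡m y<n))

mirror-shift : ∀ c {n x y} → Mirror n x y ⇔ Mirror (c + n) (c + x) y
mirror-shift c {n} {x} {y} =
  mk⇔ (λ (mirror e) → mirror (trans (shift c x y) (cong (c +_) e)))
      (λ (mirror e) → mirror (+-cancelˡ-≡ c _ _ (trans (sym (shift c x y)) e)))
  where
  shift : ∀ c x y → suc (c + x + y) ≡ c + suc (x + y)
  shift = solve-∀

mirrored? : (π : ℕ → ℕ) (n : ℕ) → Decidable (λ x → Mirror n x (π x))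
mirrored? π n x = map′ mirror sums (suc (x + π x) ≟ n)

data Position (c : ℕ) : ℕ → Set where
  inside : ∀ {x} → x < c → Position c x
  beyond : ∀ y → Position c (c + y)

position : ∀ c x → Position c x
position c x with x <? c
... | yes x<c = inside x<c
... | no x≮c = subst (Position c) (m+[n∸m]≡n (≮⇒≥ x≮c)) (beyond (x ∸ c))

module _ (c : ℕ) (cs : List ℕ) where
  private
    S : ℕ
    S = sum cs

  rlp-inside : ∀ {x} → x < c → rlp (c + S) (c ∷ cs) x ≡ S + x
  rlp-inside {x} x<c rewrite dec-true (x <? c) x<c = cong (_+ x) (m+n∸m≡n c S)

  rlp-beyond : ∀ y → rlp (c + S) (c ∷ cs) (c + y) ≡ rlp S cs y
  rlp-beyond y
    rewrite dec-false (c + y <? c) (λ c+y<c → <-irrefl refl (<-≤-trans c+y<c (m≤m+n c y)))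
          | m+n∸m≡n c S | m+n∸m≡n c y = refl

rlp-bound : ∀ cs {x} → x < sum cs → rlp (sum cs) cs x < sum cs
rlp-bound (c ∷ cs) {x} x< with position c x
... | inside x<c rewrite rlp-inside c cs x<c =
  subst (_< c + sum cs) (+-comm x (sum cs)) (+-monoˡ-< (sum cs) x<c)
... | beyond y rewrite rlp-beyond c cs y =
  ≤-trans (rlp-bound cs (+-cancelˡ-< c y (sum cs) x<)) (m≤n+m (sum cs) c)

-- Two positions in the same block behave like the identity;
-- positions in different blocks can never be mirrored; later blocks recurse.
rlp-mirror : ∀ cs {z y} → z < sum cs →
             Mirror (sum cs) (rlp (sum cs) cs z) y → Mirror (sum cs) (rlp (sum cs) cs y) z
rlp-mirror (c ∷ cs) {z} {y} z< m with position c z | position c y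
... | inside z<c | inside y<c rewrite rlp-inside c cs z<c | rlp-inside c cs y<c =
  mirror (trans (cong suc (swap (sum cs) y z)) (sums m))
  where
  swap : ∀ S y z → S + y + z ≡ S + z + y
  swap = solve-∀
... | inside z<c | beyond y′ rewrite rlp-inside c cs z<c =
  contradiction (Equivalence.from (mirror-shift c) (mirror-sym m)) λ (mirror m′) →
    <-irrefl (sym m′) (s≤s (≤-trans (m≤m+n (sum cs) z) (m≤n+m _ y′)))
... | beyond z′ | inside y<c rewrite rlp-beyond c cs z′ =
  contradiction m λ (mirror m′) → <-irrefl m′ (subst (suc (r + y) <_) (+-comm (sum cs) c)
    (subst (_≤ sum cs + c) (+-suc (suc r) y) (+-mono-≤ r<S y<c)))
  where
  r : ℕ
  r = rlp (sum cs) cs z′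
  r<S : r < sum cs
  r<S = rlp-bound cs (+-cancelˡ-< c z′ (sum cs) z<)
... | beyond z′ | beyond y′ rewrite rlp-beyond c cs z′ | rlp-beyond c cs y′ =
  mirror-sym (Equivalence.to (mirror-shift c)
    (mirror-sym (rlp-mirror cs (+-cancelˡ-< c z′ (sum cs) z<)
      (mirror-sym (Equivalence.from (mirror-shift c) (mirror-sym m))))))

rlp-prefix-high : ∀ A B {x} → x < sum A → sum B ≤ rlp (sum (A ++ B)) (A ++ B) x
rlp-prefix-high (c ∷ A) B {x} x< with position c x
... | inside x<c rewrite rlp-inside c (A ++ B) x<c =
  ≤-trans (subst (sum B ≤_) (sym (sum-++ A B)) (m≤n+m (sum B) (sum A))) (m≤m+n _ x)
... | beyond y rewrite rlp-beyond c (A ++ B) y = rlp-prefix-high A B (+-cancelˡ-< c y (sum A) x<)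

rlp-suffix-low : ∀ A B {x} → sum A ≤ x → x < sum (A ++ B) → rlp (sum (A ++ B)) (A ++ B) x < sum B
rlp-suffix-low [] B _ x< = rlp-bound B x<
rlp-suffix-low (c ∷ A) B {x} le x< with position c x
... | inside x<c = contradiction (≤-trans (m≤m+n c (sum A)) le) (<⇒≱ x<c)
... | beyond y rewrite rlp-beyond c (A ++ B) y =
  rlp-suffix-low A B (+-cancelˡ-≤ c (sum A) y le) (+-cancelˡ-< c y _ x<)

balanced-halves : ∀ cs j → let m = sum (take j cs) in 2 * m ≡ sum cs →
  (∀ {x} → x < m → m ≤ rlp (sum cs) cs x) × (∀ {x} → m ≤ x → x < sum cs → rlp (sum cs) cs x < m)
balanced-halves cs j balanced = lower , upper
  where
  A B : List ℕ
  A = take j cs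
  B = drop j cs
  m : ℕ
  m = sum A
  split : A ++ B ≡ cs
  split = take++drop≡id j cs
  rest≡m : sum B ≡ m
  rest≡m = +-cancelˡ-≡ m _ _ (begin
    m + sum B     ≡⟨ sum-++ A B ⟨
    sum (A ++ B)  ≡⟨ cong sum split ⟩
    sum cs        ≡⟨ balanced ⟨
    2 * m         ≡⟨ cong (m +_) (+-identityʳ m) ⟩
    m + m         ∎)
    where open ≡-Reasoning
  π : ℕ → ℕ
  π = rlp (sum (A ++ B)) (A ++ B)
  lower : ∀ {x} → x < m → m ≤ rlp (sum cs) cs x
  lower {x} x< = subst (λ l → m ≤ rlp (sum l) l x) split
                   (subst (_≤ π x) rest≡m (rlp-prefix-high A B x<))
  upper : ∀ {x} → m ≤ x → x < sum cs → rlp (sum cs) cs x < m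
  upper {x} le x< = subst (λ l → rlp (sum l) l x < m) split
                      (subst (π x <_) rest≡m (rlp-suffix-low A B le x<′))
    where
    x<′ : x < sum (A ++ B)
    x<′ = subst (x <_) (sym (cong sum split)) x<

inside-mirrored : ∀ c cs {x} → x < c →
  suc (2 * x) ≡ c ⇔ Mirror (c + sum cs) x (rlp (c + sum cs) (c ∷ cs) x)
inside-mirrored c cs {x} x<c rewrite rlp-inside c cs x<c =
  mk⇔ (λ e → mirror (trans (regroup x (sum cs)) (cong (_+ sum cs) e)))
      (λ (mirror e) → +-cancelʳ-≡ (sum cs) _ _ (trans (sym (regroup x (sum cs))) e))
  where
  regroup : ∀ x S → suc (x + (S + x)) ≡ suc (2 * x) + S
  regroup = solve-∀

beyond-mirrored : ∀ c cs y →
  Mirror (sum cs) y (rlp (sum cs) cs y) ⇔ Mirror (c + sum cs) (c + y) (rlp (c + sum cs) (c ∷ cs) (c + y))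
beyond-mirrored c cs y rewrite rlp-beyond c cs y = mirror-shift c

-- The odd entries of a composition correspond to the points x with rlp x = n - 1 - x:
-- each odd block contributes its centre, and even blocks contribute nothing.
numOdd-mirrored : ∀ cs → numOdd cs ≡ count (mirrored? (rlp (sum cs) cs) (sum cs)) (sum cs)
numOdd-mirrored [] = refl
numOdd-mirrored (c ∷ cs) = begin
  numOdd (c ∷ cs)
    ≡⟨ numOdd-∷ c cs ⟩
  numOdd (c ∷ []) + numOdd cs
    ≡⟨ cong₂ _+_ (sym (odd-block c)) (numOdd-mirrored cs) ⟩
  count (λ x → suc (2 * x) ≟ c) c + count (mirrored? (rlp S cs) S) S
    ≡⟨ cong₂ _+_ (count-cong _ _ c λ x x<c → inside-mirrored c cs x<c)
                 (count-cong _ _ S λ y _ → beyond-mirrored c cs y) ⟩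
  count (mirrored? π (c + S)) c + count (λ y → mirrored? π (c + S) (c + y)) S
    ≡⟨ count-+ (mirrored? π (c + S)) c S ⟨
  count (mirrored? π (c + S)) (c + S)
    ∎
  where
  open ≡-Reasoning
  S : ℕ
  S = sum cs
  π : ℕ → ℕ
  π = rlp (c + S) (c ∷ cs)

iter-+ : ∀ f i j x → iter f (i + j) x ≡ iter f i (iter f j x)
iter-+ f zero j x = refl
iter-+ f (suc i) j x = cong f (iter-+ f i j x)

iter-suc′ : ∀ f i x → iter f (suc i) x ≡ iter f i (f x)
iter-suc′ f i x = trans (cong (λ t → iter f t x) (+-comm 1 i)) (iter-+ f i 1 x)

module CyclicOrbit (π : ℕ → ℕ) (n : ℕ) (0<n : 0 < n)
  (maps-to : ∀ {x} → x < n → π x < n)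
  (injective : ∀ {x y} → x < n → y < n → π x ≡ π y → x ≡ y)
  (covers : ∀ j → j < n → ∃ λ k → iter π k 0 ≡ j) where

  private instance
    n-nonZero : NonZero n
    n-nonZero = >-nonZero 0<n

  orbit : ℕ → ℕ
  orbit k = iter π k 0

  iter-bound : ∀ k {x} → x < n → iter π k x < n
  iter-bound zero x<n = x<n
  iter-bound (suc k) x<n = maps-to (iter-bound k x<n)

  orbit-bound : ∀ k → orbit k < n
  orbit-bound k = iter-bound k 0<n

  iter-injective : ∀ k {x y} → x < n → y < n → iter π k x ≡ iter π k y → x ≡ y
  iter-injective zero _ _ e = e
  iter-injective (suc k) x<n y<n e =
    iter-injective k x<n y<n (injective (iter-bound k x<n) (iter-bound k y<n) e)

  returns : ∀ i d → orbit (i + d) ≡ orbit i → orbit d ≡ 0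
  returns i d e = iter-injective i (orbit-bound d) 0<n (trans (sym (iter-+ π i d 0)) e)

  periodic : ∀ p .{{_ : NonZero p}} → orbit p ≡ 0 → ∀ k → orbit k ≡ orbit (k % p)
  periodic p op≡0 k = begin
    orbit k                               ≡⟨ cong orbit (m≡m%n+[m/n]*n k p) ⟩
    orbit (k % p + (k / p) * p)           ≡⟨ iter-+ π (k % p) ((k / p) * p) 0 ⟩
    iter π (k % p) (orbit ((k / p) * p))  ≡⟨ cong (iter π (k % p)) (multiple (k / p)) ⟩
    orbit (k % p)                         ∎
    where
    open ≡-Reasoning
    multiple : ∀ q → orbit (q * p) ≡ 0
    multiple zero = refl
    multiple (suc q) = trans (iter-+ π p (q * p) 0) (trans (cong (iter π p) (multiple q)) op≡0)

  -- Since the orbit covers n points, every return time is at least n.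
  return-time-≥ : ∀ {p} → 0 < p → orbit p ≡ 0 → n ≤ p
  return-time-≥ {p} 0<p op≡0 = ≮⇒≥ λ p<n →
    let (x , y , x<y , same) = pigeonhole p<n residue
    in <⇒≢ x<y (trans (time x) (trans (cong (λ r → orbit (toℕ r)) same) (sym (time y))))
    where
    instance
      p-nonZero : NonZero p
      p-nonZero = >-nonZero 0<p
    -- x is visited at time-of x, hence also at the residue of that time modulo p
    time-of : Fin n → ℕ
    time-of x = proj₁ (covers (toℕ x) (toℕ<n x))
    residue : Fin n → Fin p
    residue x = fromℕ< (m%n<n (time-of x) p)
    time : ∀ x → toℕ x ≡ orbit (toℕ (residue x))
    time x = begin
      toℕ x                    ≡⟨ proj₂ (covers (toℕ x) (toℕ<n x)) ⟨
      orbit (time-of x)        ≡⟨ periodic p op≡0 (time-of x) ⟩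
      orbit (time-of x % p)    ≡⟨ cong orbit (toℕ-fromℕ< (m%n<n (time-of x) p)) ⟨
      orbit (toℕ (residue x))  ∎
      where open ≡-Reasoning

  coincide : ∀ {i j} → i < j → orbit i ≡ orbit j → n ≤ j ∸ i × orbit (j ∸ i) ≡ 0
  coincide {i} {j} i<j e = return-time-≥ (m<n⇒0<n∸m i<j) returned , returned
    where
    returned : orbit (j ∸ i) ≡ 0
    returned = returns i (j ∸ i) (trans (cong orbit (m+[n∸m]≡n (<⇒≤ i<j))) (sym e))

  orbit-period : orbit n ≡ 0
  orbit-period =
    let (i , j , i<j , same) = pigeonhole (n<1+n n) (λ k → fromℕ< (orbit-bound (toℕ k)))
        (n≤gap , returned) = coincide i<j (trans (sym (visit i)) (trans (cong toℕ same) (visit j)))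
        j≤n = s≤s⁻¹ (toℕ<n j)
    in subst (λ t → orbit t ≡ 0) (≤-antisym (≤-trans (m∸n≤m (toℕ j) (toℕ i)) j≤n) n≤gap) returned
    where
    visit : ∀ (k : Fin (suc n)) → toℕ (fromℕ< (orbit-bound (toℕ k))) ≡ orbit (toℕ k)
    visit k = toℕ-fromℕ< (orbit-bound (toℕ k))

  orbit-injective : ∀ {i j} → i < n → j < n → orbit i ≡ orbit j → i ≡ j
  orbit-injective {i} {j} i<n j<n e with <-cmp i j
  ... | tri< i<j _ _ = contradiction (≤-trans (proj₁ (coincide i<j e)) (m∸n≤m j i)) (<⇒≱ j<n)
  ... | tri≈ _ i≡j _ = i≡j
  ... | tri> _ _ j<i = contradiction (≤-trans (proj₁ (coincide j<i (sym e))) (m∸n≤m i j)) (<⇒≱ i<n)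

  orbit-+n : ∀ k → orbit (k + n) ≡ orbit k
  orbit-+n k = trans (iter-+ π k n 0) (cong (iter π k) orbit-period)

  reach : ∀ j → j < n → ∃ λ k → k < n × orbit k ≡ j
  reach j j<n = let (k , e) = covers j j<n
                in k % n , m%n<n k n , trans (sym (periodic n orbit-period k)) e

  collision : ∀ {i j} → i < n → j < n + n → orbit j ≡ orbit i → j ≡ i ⊎ j ≡ i + n
  collision {i} {j} i<n j<2n e with j <? n
  ... | yes j<n = inj₁ (orbit-injective j<n i<n e)
  ... | no j≮n = inj₂ (trans (sym r+n≡j) (cong (_+ n) r≡i))
    where
    r : ℕ
    r = j ∸ n
    r+n≡j : r + n ≡ j
    r+n≡j = m∸n+n≡m (≮⇒≥ j≮n)
    r<n : r < n
    r<n = subst (r <_) (m+n∸n≡m n n) (∸-monoˡ-< j<2n (≮⇒≥ j≮n))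
    r≡i : r ≡ i
    r≡i = orbit-injective r<n i<n (trans (sym (orbit-+n r)) (trans (cong orbit r+n≡j) e))

module HalfSwapping (π : ℕ → ℕ) (n m : ℕ) (2m≡n : 2 * m ≡ n) (0<m : 0 < m)
  (maps-to : ∀ {x} → x < n → π x < n)
  (self-adjoint : ∀ {z y} → z < n → Mirror n (π z) y → Mirror n (π y) z)
  (lower→upper : ∀ {x} → x < m → m ≤ π x)
  (upper→lower : ∀ {x} → m ≤ x → x < n → π x < m)
  (covers : ∀ j → j < n → ∃ λ k → iter π k 0 ≡ j) where

  0<n : 0 < n
  0<n = subst (0 <_) 2m≡n (≤-trans 0<m (m≤m+n m _))

  adjoint : ∀ {z y} → z < n → y < n → Mirror n (π z) y ⇔ Mirror n z (π y)
  adjoint z<n y<n = mk⇔ (λ m → mirror-sym (self-adjoint z<n m)) (λ m → self-adjoint y<n (mirror-sym m))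

  -- Self-adjointness makes π injective: π x determines the mirror image of x.
  injective : ∀ {x y} → x < n → y < n → π x ≡ π y → x ≡ y
  injective {x} {y} x<n y<n e =
    mirror-unique (partner x<n) (subst (λ v → Mirror n (π (n ∸ suc v)) y) (sym e) (partner y<n))
    where
    partner : ∀ {x} → x < n → Mirror n (π (n ∸ suc (π x))) x
    partner x<n = self-adjoint x<n (mirror-sym (mirror-exists (maps-to x<n)))

  open CyclicOrbit π n 0<n maps-to injective covers

  iter-adjoint : ∀ i {z y} → z < n → y < n → Mirror n (iter π i z) y ⇔ Mirror n z (iter π i y)
  iter-adjoint zero _ _ = ⇔-id _
  iter-adjoint (suc i) {z} {y} z<n y<n =
    subst (λ v → Mirror n (π (iter π i z)) y ⇔ Mirror n z v) (sym (iter-suc′ π i y))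
      (iter-adjoint i z<n (maps-to y<n) ⇔-∘ adjoint (iter-bound i z<n) y<n)

  orbit-mirrored : ∀ k → Mirror n (orbit k) (π (orbit k)) ⇔ Mirror n 0 (orbit (suc (2 * k)))
  orbit-mirrored k = subst (λ v → Mirror n (orbit k) (π (orbit k)) ⇔ Mirror n 0 v) at-2k+1
                       (iter-adjoint k 0<n (orbit-bound (suc k)))
    where
    at-2k+1 : iter π k (orbit (suc k)) ≡ orbit (suc (2 * k))
    at-2k+1 = trans (sym (iter-+ π k (suc k) 0)) (cong orbit (k+[1+k]≡1+2k k))
      where
      k+[1+k]≡1+2k : ∀ k → k + suc k ≡ suc (2 * k)
      k+[1+k]≡1+2k = solve-∀

  alternation : ∀ k → orbit (2 * k) < m × m ≤ orbit (suc (2 * k))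
  alternation zero = 0<m , lower→upper 0<m
  alternation (suc k) rewrite +-suc k (k + 0) =
    let lower = upper→lower (proj₂ (alternation k)) (orbit-bound (suc (2 * k)))
    in lower , lower→upper lower

  top : ℕ
  top = n ∸ 1

  top-mirror : Mirror n 0 top
  top-mirror = mirror-sym (mirror-exists 0<n)

  top<n : top < n
  top<n = subst (top <_) (sums top-mirror) ≤-refl

  m≤top : m ≤ top
  m≤top = s≤s⁻¹ (subst (m <_) (trans (*-comm m 2) (trans 2m≡n (sym (sums top-mirror)))) (m<m*n m 2 ≤-refl))
    where instance
      m-nonZero : NonZero m
      m-nonZero = >-nonZero 0<m

  -- Since top is in the upper half, the orbit reaches it at an odd time 2a + 1, a < m.
  top-at-odd-time : ∃ λ a → a < m × Mirror n 0 (orbit (suc (2 * a)))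
  top-at-odd-time = let (t , t<n , reached) = reach top top<n in odd-time t t<n reached
    where
    odd-time : ∀ t → t < n → orbit t ≡ top → ∃ λ a → a < m × Mirror n 0 (orbit (suc (2 * a)))
    odd-time t t<n reached with t % 2 ≟ 1
    ... | yes odd =
      t / 2 , a<m , subst (λ v → Mirror n 0 (orbit v)) t≡ (subst (Mirror n 0) (sym reached) top-mirror)
      where
      t≡ : t ≡ suc (2 * (t / 2))
      t≡ = odd-form t odd
      a<m : t / 2 < m
      a<m = *-cancelˡ-< 2 (t / 2) m
              (<-trans (n<1+n _) (subst (_< 2 * m) t≡ (subst (t <_) (sym 2m≡n) t<n)))
    ... | no even = contradiction (subst (m ≤_) (sym reached) m≤top)
                      (<⇒≱ (subst (λ v → orbit v < m) (sym (even-form t even)) (proj₁ (alternation (t / 2)))))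

  odd-below : ∀ {k N} → k < N → suc (2 * k) < 2 * N
  odd-below {k} {N} k<N = subst (_≤ 2 * N) (*-suc 2 k) (*-monoʳ-≤ 2 k<N)

  module MirroredPoints (a : ℕ) (a<m : a < m) (reached : Mirror n 0 (orbit (suc (2 * a)))) where

    a<n : a < n
    a<n = <-≤-trans a<m (subst (m ≤_) 2m≡n (m≤m+n m _))

    a+m<n : a + m < n
    a+m<n = subst (a + m <_) (trans (cong (m +_) (sym (+-identityʳ m))) 2m≡n) (+-monoˡ-< m a<m)

    shift : suc (2 * (a + m)) ≡ suc (2 * a) + n
    shift = trans (cong suc (*-distribˡ-+ 2 a m)) (cong (suc (2 * a) +_) 2m≡n)

    half-period-later : orbit (suc (2 * (a + m))) ≡ orbit (suc (2 * a))
    half-period-later = trans (cong orbit shift) (orbit-+n (suc (2 * a)))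

    first : Mirror n (orbit a) (π (orbit a))
    first = Equivalence.from (orbit-mirrored a) reached

    second : Mirror n (orbit (a + m)) (π (orbit (a + m)))
    second = Equivalence.from (orbit-mirrored (a + m))
               (subst (Mirror n 0) (sym half-period-later) reached)

    distinct : orbit a ≢ orbit (a + m)
    distinct e = <⇒≢ 0<m (sym (+-cancelˡ-≡ a m 0
                   (trans (sym (orbit-injective a<n a+m<n e)) (sym (+-identityʳ a)))))

    -- Any mirrored x = orbit k forces 2k + 1 ≡ 2a + 1 modulo n, so k = a or k = a + m.
    only : ∀ x → x < n → Mirror n x (π x) → x ≡ orbit a ⊎ x ≡ orbit (a + m)
    only x x<n mirrored =
      let (k , k<n , visits) = reach x x<n
          same : orbit (suc (2 * k)) ≡ orbit (suc (2 * a))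
          same = mirror-unique (Equivalence.to (orbit-mirrored k)
                   (subst (λ v → Mirror n v (π v)) (sym visits) mirrored)) reached
      in ⊎-map (λ e → trans (sym visits) (cong orbit (halve-odd k a e)))
                      (λ e → trans (sym visits) (cong orbit (halve-odd k (a + m) (trans e (sym shift)))))
           (collision (subst (suc (2 * a) <_) 2m≡n (odd-below a<m))
                      (subst (suc (2 * k) <_) (cong (n +_) (+-identityʳ n)) (odd-below k<n)) same)
      where
      halve-odd : ∀ k l → suc (2 * k) ≡ suc (2 * l) → k ≡ l
      halve-odd k l e = *-cancelˡ-≡ k l 2 (suc-injective e)

    count-mirrored : count (mirrored? π n) n ≡ 2
    count-mirrored =
      count-two (mirrored? π n) (orbit-bound a) (orbit-bound (a + m)) distinct first second only

  mirrored-points : count (mirrored? π n) n ≡ 2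
  mirrored-points =
    let (a , a<m , reached) = top-at-odd-time in MirroredPoints.count-mirrored a a<m reached

proposition3p5 : (n : ℕ) (cs : List ℕ) → IsComposition n cs → Cyclic cs → Balanced cs → numOdd cs ≡ 2
proposition3p5 _ cs _ (0<S , covers) (j , balanced) = begin
  numOdd cs                         ≡⟨ numOdd-mirrored cs ⟩
  count (mirrored? (rlp S cs) S) S  ≡⟨ HalfSwapping.mirrored-points (rlp S cs) S m balanced 0<m
                                         (rlp-bound cs) (rlp-mirror cs) lower upper covers ⟩
  2                                 ∎
  where
  open ≡-Reasoning
  S m : ℕ
  S = sum cs
  m = sum (take j cs)
  0<m : 0 < m
  0<m = n≢0⇒n>0 λ m≡0 → <-irrefl (trans (cong (2 *_) (sym m≡0)) balanced) 0<S
  lower : ∀ {x} → x < m → m ≤ rlp S cs x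
  lower = proj₁ (balanced-halves cs j balanced)
  upper : ∀ {x} → m ≤ x → x < S → rlp S cs x < m
  upper = proj₂ (balanced-halves cs j balanced)
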